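{- Let $(G_j)_{j\in\mathbb Z}$ and $(H_j)_{j\in\mathbb Z}$ be gibonacci sequences. For all integers $r$, $s$, $k$, $$H_sG_{k+r}+(-1)^{r-1}H_{s-r}G_k=F_r\left(G_0H_{k+s-1}+G_1H_{k+s}\right).$$
   Context: $F_j$ denotes the Fibonacci numbers (for all integers $j$). A gibonacci sequence is a sequence $(G_j)_{j\in\mathbb Z}$ with arbitrary initial values $G_0,G_1$, not both zero, satisfying $G_j=G_{j-1}+G_{j-2}$ for all integers $j$; similarly for $(H_j)$ with seeds $H_0,H_1$. -}

module Defs where

open import Level using (Level)
open import Data.Nat as ℕ using (ℕ; zero; suc)
open import Data.Integer as ℤ using (ℤ; +_; -[1+_])
open import Algebra.Bundles using (CommutativeRing)
open import Relation.Binary.PropositionalEquality using (_≡_)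
open import Relation.Nullary using (¬_)
open import Data.Product using (_×_)

module _ {c ℓ : Level} (R : CommutativeRing c ℓ) where
  open CommutativeRing R

  fibℕ : ℕ → Carrier
  fibℕ zero = 0#
  fibℕ (suc zero) = 1#
  fibℕ (suc (suc n)) = fibℕ (suc n) + fibℕ n

  signℕ : ℕ → Carrier
  signℕ zero = 1#
  signℕ (suc n) = - signℕ n

  sign : ℤ → Carrier
  sign z = signℕ ℤ.∣ z ∣

  -- Fibonacci numbers F_j for all integers j, with F_{-m} = (-1)^(m+1) F_m
  fib : ℤ → Carrier
  fib (+ n) = fibℕ n
  fib -[1+ n ] = signℕ n * fibℕ (suc n)

  IsGibonacci : (ℤ → Carrier) → Set ℓ
  IsGibonacci G =
    (∀ j → G j ≈ G (j ℤ.- ℤ.+ 1) + G (j ℤ.- ℤ.+ 2)) ×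
    ¬ (G (ℤ.+ 0) ≈ 0# × G (ℤ.+ 1) ≈ 0#)

-- Both sides are, as functions of r, solutions of the Fibonacci recurrence: the
-- left one because the recurrence is preserved by shifts, by linear combinations
-- and by the alternating reflection j ↦ (-1)^(j-1) a(m - j). A solution is
-- determined by its values at 0 and 1. At r = 0 the left side cancels; at r = 1
-- the identity reads H_s G_(k+1) + H_(s-1) G_k = G_0 H_(k+s-1) + G_1 H_(k+s),
-- which follows in the same way by viewing both sides as solutions in k.
module Submission where

open import Defs
open import Level using (Level)
open import Data.Integer as ℤ using (ℤ; +_; -[1+_])
open import Algebra.Bundles using (CommutativeRing)
open import Data.Nat.Base using (zero; suc)
import Data.Nat.Properties as ℕ
import Data.Integer.Properties as ℤ
open import Data.Integer.Tactic.RingSolver using (solve-∀)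
open import Data.Product using (_×_; _,_; proj₁)
open import Relation.Binary.PropositionalEquality as ≡ using (_≡_)
import Relation.Binary.Reasoning.Setoid as SetoidReasoning

ℤ-induction : ∀ {p} (P : ℤ → Set p) → P (+ 0) →
              (∀ j → P j → P (ℤ.suc j)) → (∀ j → P (ℤ.suc j) → P j) →
              ∀ j → P j
ℤ-induction P P₀ up down (+ zero)        = P₀
ℤ-induction P P₀ up down (+ suc n)       = up (+ n) (ℤ-induction P P₀ up down (+ n))
ℤ-induction P P₀ up down -[1+ zero ]     = down -[1+ 0 ] P₀
ℤ-induction P P₀ up down -[1+ suc n ]    = down -[1+ suc n ] (ℤ-induction P P₀ up down -[1+ n ])

2+j-1≡1+j : ∀ j → + 1 ℤ.+ (+ 1 ℤ.+ j) ℤ.- + 1 ≡ + 1 ℤ.+ j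
2+j-1≡1+j = solve-∀

2+j-2≡j : ∀ j → + 1 ℤ.+ (+ 1 ℤ.+ j) ℤ.- + 2 ≡ j
2+j-2≡j = solve-∀

i+m-n≡i-n+m : ∀ i m n → i ℤ.+ m ℤ.- n ≡ i ℤ.- n ℤ.+ m
i+m-n≡i-n+m = solve-∀

-[j-2]-1≡-[j-1] : ∀ j → ℤ.- (j ℤ.- + 2) ℤ.- + 1 ≡ ℤ.- (j ℤ.- + 1)
-[j-2]-1≡-[j-1] = solve-∀

-[j-2]-2≡-j : ∀ j → ℤ.- (j ℤ.- + 2) ℤ.- + 2 ≡ ℤ.- j
-[j-2]-2≡-j = solve-∀

1+j-1≡j : ∀ j → + 1 ℤ.+ j ℤ.- + 1 ≡ j
1+j-1≡j = solve-∀

1+j-2≡j-1 : ∀ j → + 1 ℤ.+ j ℤ.- + 2 ≡ j ℤ.- + 1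
1+j-2≡j-1 = solve-∀

j-2-1≡j-1-1-1 : ∀ j → j ℤ.- + 2 ℤ.- + 1 ≡ j ℤ.- + 1 ℤ.- + 1 ℤ.- + 1
j-2-1≡j-1-1-1 = solve-∀

-[1+n]-1≡-[1+1+n] : ∀ n → -[1+ n ] ℤ.- + 1 ≡ -[1+ suc n ]
-[1+n]-1≡-[1+1+n] n = ≡.cong (λ m → -[1+ suc m ]) (ℕ.+-identityʳ n)

-[1+n]-2≡-[1+2+n] : ∀ n → -[1+ n ] ℤ.- + 2 ≡ -[1+ suc (suc n) ]
-[1+n]-2≡-[1+2+n] n = ≡.cong (λ m → -[1+ suc m ]) (ℕ.+-comm n 1)

module _ {c ℓ : Level} (R : CommutativeRing c ℓ) where
  open CommutativeRing R
  open import Algebra.Properties.Ring ring using (-1*x≈-x; -‿involutive; -‿distribˡ-*; +-cancelˡ)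
  open SetoidReasoning setoid
  open import Algebra.Solver.Ring.NaturalCoefficients.Default commutativeSemiring
    using (solve; _:=_; _:+_; _:*_)

  -x*y+x*[y+z]≈x*z : ∀ x y z → - x * y + x * (y + z) ≈ x * z
  -x*y+x*[y+z]≈x*z x y z = begin
    - x * y + x * (y + z)          ≈⟨ +-cong (sym (-‿distribˡ-* x y)) (distribˡ x y z) ⟩
    - (x * y) + (x * y + x * z)    ≈⟨ +-assoc _ _ _ ⟨
    (- (x * y) + x * y) + x * z    ≈⟨ +-congʳ (-‿inverseˡ (x * y)) ⟩
    0# + x * z                     ≈⟨ +-identityˡ (x * z) ⟩
    x * z                          ∎

  Recurrent : (ℤ → Carrier) → Set ℓ
  Recurrent a = ∀ j → a j ≈ a (j ℤ.- + 1) + a (j ℤ.- + 2)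

  ≈-at : (a : ℤ → Carrier) {i j : ℤ} → i ≡ j → a i ≈ a j
  ≈-at a i≡j = reflexive (≡.cong a i≡j)

  recurrent-forward : ∀ {a} → Recurrent a → ∀ j → a (ℤ.suc (ℤ.suc j)) ≈ a (ℤ.suc j) + a j
  recurrent-forward {a} rec j =
    trans (rec (ℤ.suc (ℤ.suc j))) (+-cong (≈-at a (2+j-1≡1+j j)) (≈-at a (2+j-2≡j j)))

  recurrent-unique : ∀ {a b} → Recurrent a → Recurrent b →
                     a (+ 0) ≈ b (+ 0) → a (+ 1) ≈ b (+ 1) → ∀ j → a j ≈ b j
  recurrent-unique {a} {b} recA recB a₀≈b₀ a₁≈b₁ j =
    proj₁ (ℤ-induction AgreeFrom (a₀≈b₀ , a₁≈b₁) up down j)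
    where
    AgreeFrom : ℤ → Set ℓ
    AgreeFrom i = a i ≈ b i × a (ℤ.suc i) ≈ b (ℤ.suc i)

    sum-agrees : ∀ i → a (ℤ.suc (ℤ.suc i)) ≈ b (ℤ.suc (ℤ.suc i)) →
                 a (ℤ.suc i) + a i ≈ b (ℤ.suc i) + b i
    sum-agrees i eq = trans (sym (recurrent-forward recA i)) (trans eq (recurrent-forward recB i))

    up : ∀ i → AgreeFrom i → AgreeFrom (ℤ.suc i)
    up i (eq₀ , eq₁) = eq₁ , (begin
      a (ℤ.suc (ℤ.suc i))  ≈⟨ recurrent-forward recA i ⟩
      a (ℤ.suc i) + a i    ≈⟨ +-cong eq₁ eq₀ ⟩
      b (ℤ.suc i) + b i    ≈⟨ recurrent-forward recB i ⟨
      b (ℤ.suc (ℤ.suc i))  ∎)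

    down : ∀ i → AgreeFrom (ℤ.suc i) → AgreeFrom i
    down i (eq₁ , eq₂) =
      +-cancelˡ (b (ℤ.suc i)) (a i) (b i) (trans (+-congʳ (sym eq₁)) (sum-agrees i eq₂)) , eq₁

  recurrent-resp : ∀ {a b} → (∀ j → a j ≈ b j) → Recurrent a → Recurrent b
  recurrent-resp {a} {b} a≈b rec j =
    trans (sym (a≈b j)) (trans (rec j) (+-cong (a≈b _) (a≈b _)))

  recurrent-+ : ∀ {a b} → Recurrent a → Recurrent b → Recurrent (λ j → a j + b j)
  recurrent-+ {a} {b} recA recB j = begin
    a j + b j                                    ≈⟨ +-cong (recA j) (recB j) ⟩
    (a j₁ + a j₂) + (b j₁ + b j₂)                ≈⟨ +-assoc _ _ _ ⟩
    a j₁ + (a j₂ + (b j₁ + b j₂))                ≈⟨ +-congˡ (x+[y+z]≈y+[x+z]) ⟩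
    a j₁ + (b j₁ + (a j₂ + b j₂))                ≈⟨ +-assoc _ _ _ ⟨
    (a j₁ + b j₁) + (a j₂ + b j₂)                ∎
    where
    j₁ = j ℤ.- + 1
    j₂ = j ℤ.- + 2
    x+[y+z]≈y+[x+z] : a j₂ + (b j₁ + b j₂) ≈ b j₁ + (a j₂ + b j₂)
    x+[y+z]≈y+[x+z] = trans (sym (+-assoc _ _ _)) (trans (+-congʳ (+-comm _ _)) (+-assoc _ _ _))

  recurrent-*ˡ : ∀ {a} x → Recurrent a → Recurrent (λ j → x * a j)
  recurrent-*ˡ x rec j = trans (*-congˡ (rec j)) (distribˡ x _ _)

  recurrent-*ʳ : ∀ {a} x → Recurrent a → Recurrent (λ j → a j * x)
  recurrent-*ʳ x rec j = trans (*-congʳ (rec j)) (distribʳ x _ _)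

  recurrent-shiftʳ : ∀ {a} → Recurrent a → ∀ m → Recurrent (λ j → a (j ℤ.+ m))
  recurrent-shiftʳ {a} rec m j =
    trans (rec (j ℤ.+ m)) (+-cong (≈-at a (i+m-n≡i-n+m j m (+ 1))) (≈-at a (i+m-n≡i-n+m j m (+ 2))))

  recurrent-shiftˡ : ∀ {a} → Recurrent a → ∀ m → Recurrent (λ j → a (m ℤ.+ j))
  recurrent-shiftˡ {a} rec m = recurrent-resp (λ j → ≈-at a (ℤ.+-comm j m)) (recurrent-shiftʳ rec m)

  sign-pred : ∀ z → sign R (z ℤ.- + 1) ≈ - sign R z
  sign-pred (+ zero)  = refl
  sign-pred (+ suc n) = sym (-‿involutive _)
  sign-pred -[1+ n ]  = ≈-at (sign R) (-[1+n]-1≡-[1+1+n] n)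

  recurrent-alternate : ∀ {a} → Recurrent a → Recurrent (λ j → sign R (j ℤ.- + 1) * a (ℤ.- j))
  recurrent-alternate {a} rec j = sym (begin
    sign R (j ℤ.- + 1 ℤ.- + 1) * a (ℤ.- (j ℤ.- + 1)) + sign R (j ℤ.- + 2 ℤ.- + 1) * a (ℤ.- (j ℤ.- + 2))
      ≈⟨ +-cong (*-congʳ (sign-pred (j ℤ.- + 1))) (*-cong σ[j-3]≈σ a[2-j]≈a[1-j]+a[-j]) ⟩
    - σ * a (ℤ.- (j ℤ.- + 1)) + σ * (a (ℤ.- (j ℤ.- + 1)) + a (ℤ.- j))
      ≈⟨ -x*y+x*[y+z]≈x*z σ _ _ ⟩
    σ * a (ℤ.- j) ∎)
    where
    σ = sign R (j ℤ.- + 1)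
    σ[j-3]≈σ : sign R (j ℤ.- + 2 ℤ.- + 1) ≈ σ
    σ[j-3]≈σ = begin
      sign R (j ℤ.- + 2 ℤ.- + 1)            ≈⟨ ≈-at (sign R) (j-2-1≡j-1-1-1 j) ⟩
      sign R (j ℤ.- + 1 ℤ.- + 1 ℤ.- + 1)    ≈⟨ sign-pred (j ℤ.- + 1 ℤ.- + 1) ⟩
      - sign R (j ℤ.- + 1 ℤ.- + 1)          ≈⟨ -‿cong (sign-pred (j ℤ.- + 1)) ⟩
      - - σ                                 ≈⟨ -‿involutive σ ⟩
      σ                                     ∎
    a[2-j]≈a[1-j]+a[-j] : a (ℤ.- (j ℤ.- + 2)) ≈ a (ℤ.- (j ℤ.- + 1)) + a (ℤ.- j)
    a[2-j]≈a[1-j]+a[-j] = trans (rec (ℤ.- (j ℤ.- + 2)))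
      (+-cong (≈-at a (-[j-2]-1≡-[j-1] j)) (≈-at a (-[j-2]-2≡-j j)))

  fib-recurrent : Recurrent (fib R)
  fib-recurrent (+ zero) = sym (begin
    1# * 1# + - 1# * (1# + 0#)   ≈⟨ +-cong (*-identityˡ 1#) (trans (-1*x≈-x _) (-‿cong (+-identityʳ 1#))) ⟩
    1# + - 1#                    ≈⟨ -‿inverseʳ 1# ⟩
    0#                           ∎)
  fib-recurrent (+ suc zero) = sym (trans (+-identityˡ _) (*-identityˡ 1#))
  fib-recurrent (+ suc (suc n)) = refl
  fib-recurrent -[1+ n ] = sym (begin
    fib R (-[1+ n ] ℤ.- + 1) + fib R (-[1+ n ] ℤ.- + 2)
      ≈⟨ +-cong (≈-at (fib R) (-[1+n]-1≡-[1+1+n] n)) (≈-at (fib R) (-[1+n]-2≡-[1+2+n] n)) ⟩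
    - σ * F₂ + - - σ * (F₂ + F₁)   ≈⟨ +-congˡ (*-congʳ (-‿involutive σ)) ⟩
    - σ * F₂ + σ * (F₂ + F₁)       ≈⟨ -x*y+x*[y+z]≈x*z σ F₂ F₁ ⟩
    σ * F₁                         ∎)
    where
    σ  = signℕ R n
    F₁ = fibℕ R (suc n)
    F₂ = fibℕ R (suc (suc n))

  module _ {G H : ℤ → Carrier} (recG : Recurrent G) (recH : Recurrent H) where

    cross-sum-by-seeds : ∀ s k → H s * G (k ℤ.+ + 1) + H (s ℤ.- + 1) * G k
                                 ≈ G (+ 0) * H (k ℤ.+ s ℤ.- + 1) + G (+ 1) * H (k ℤ.+ s)
    cross-sum-by-seeds s = recurrent-unique lhs-recurrent rhs-recurrent base₀ base₁
      where
      lhs-recurrent : Recurrent (λ k → H s * G (k ℤ.+ + 1) + H (s ℤ.- + 1) * G k)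
      lhs-recurrent = recurrent-+ (recurrent-*ˡ (H s) (recurrent-shiftʳ recG (+ 1)))
                                  (recurrent-*ˡ (H (s ℤ.- + 1)) recG)

      rhs-recurrent : Recurrent (λ k → G (+ 0) * H (k ℤ.+ s ℤ.- + 1) + G (+ 1) * H (k ℤ.+ s))
      rhs-recurrent = recurrent-+
        (recurrent-*ˡ (G (+ 0)) (recurrent-resp (λ k → ≈-at H (≡.sym (ℤ.+-assoc k s (ℤ.- + 1))))
                                                (recurrent-shiftʳ recH (s ℤ.- + 1))))
        (recurrent-*ˡ (G (+ 1)) (recurrent-shiftʳ recH s))

      base₀ : H s * G (+ 1) + H (s ℤ.- + 1) * G (+ 0)
              ≈ G (+ 0) * H (+ 0 ℤ.+ s ℤ.- + 1) + G (+ 1) * H (+ 0 ℤ.+ s)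
      base₀ = begin
        H s * G (+ 1) + H (s ℤ.- + 1) * G (+ 0)   ≈⟨ +-comm _ _ ⟩
        H (s ℤ.- + 1) * G (+ 0) + H s * G (+ 1)   ≈⟨ +-cong (*-comm _ _) (*-comm _ _) ⟩
        G (+ 0) * H (s ℤ.- + 1) + G (+ 1) * H s
          ≈⟨ +-cong (*-congˡ (≈-at H (≡.cong (ℤ._- + 1) (≡.sym (ℤ.+-identityˡ s)))))
                    (*-congˡ (≈-at H (≡.sym (ℤ.+-identityˡ s)))) ⟩
        G (+ 0) * H (+ 0 ℤ.+ s ℤ.- + 1) + G (+ 1) * H (+ 0 ℤ.+ s) ∎

      H[1+s]≈H[s]+H[s-1] : H (+ 1 ℤ.+ s) ≈ H s + H (s ℤ.- + 1)
      H[1+s]≈H[s]+H[s-1] = trans (recH (+ 1 ℤ.+ s)) (+-cong (≈-at H (1+j-1≡j s)) (≈-at H (1+j-2≡j-1 s)))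

      base₁ : H s * G (+ 2) + H (s ℤ.- + 1) * G (+ 1)
              ≈ G (+ 0) * H (+ 1 ℤ.+ s ℤ.- + 1) + G (+ 1) * H (+ 1 ℤ.+ s)
      base₁ = begin
        H s * G (+ 2) + H (s ℤ.- + 1) * G (+ 1)                   ≈⟨ +-congʳ (*-congˡ (recG (+ 2))) ⟩
        H s * (G (+ 1) + G (+ 0)) + H (s ℤ.- + 1) * G (+ 1)
          ≈⟨ solve 4 (λ x y g₁ g₀ → x :* (g₁ :+ g₀) :+ y :* g₁ := g₀ :* x :+ g₁ :* (x :+ y))
                   refl (H s) (H (s ℤ.- + 1)) (G (+ 1)) (G (+ 0)) ⟩
        G (+ 0) * H s + G (+ 1) * (H s + H (s ℤ.- + 1))
          ≈⟨ +-cong (*-congˡ (≈-at H (≡.sym (1+j-1≡j s)))) (*-congˡ (sym H[1+s]≈H[s]+H[s-1])) ⟩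
        G (+ 0) * H (+ 1 ℤ.+ s ℤ.- + 1) + G (+ 1) * H (+ 1 ℤ.+ s) ∎

    recurrent-product-identity :
      ∀ r s k → H s * G (k ℤ.+ r) + sign R (r ℤ.- + 1) * H (s ℤ.- r) * G k
                ≈ fib R r * (G (+ 0) * H (k ℤ.+ s ℤ.- + 1) + G (+ 1) * H (k ℤ.+ s))
    recurrent-product-identity r s k = recurrent-unique lhs-recurrent rhs-recurrent base₀ base₁ r
      where
      C = G (+ 0) * H (k ℤ.+ s ℤ.- + 1) + G (+ 1) * H (k ℤ.+ s)

      lhs-recurrent : Recurrent (λ r → H s * G (k ℤ.+ r) + sign R (r ℤ.- + 1) * H (s ℤ.- r) * G k)
      lhs-recurrent = recurrent-+ (recurrent-*ˡ (H s) (recurrent-shiftˡ recG k))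
                                  (recurrent-*ʳ (G k) (recurrent-alternate (recurrent-shiftˡ recH s)))

      rhs-recurrent : Recurrent (λ r → fib R r * C)
      rhs-recurrent = recurrent-*ʳ C fib-recurrent

      base₀ : H s * G (k ℤ.+ + 0) + - 1# * H (s ℤ.- + 0) * G k ≈ 0# * C
      base₀ = begin
        H s * G (k ℤ.+ + 0) + - 1# * H (s ℤ.- + 0) * G k
          ≈⟨ +-cong (*-congˡ (≈-at G (ℤ.+-identityʳ k))) (*-congʳ (*-congˡ (≈-at H (ℤ.+-identityʳ s)))) ⟩
        H s * G k + - 1# * H s * G k      ≈⟨ +-congˡ (trans (*-assoc _ _ _) (-1*x≈-x _)) ⟩
        H s * G k + - (H s * G k)         ≈⟨ -‿inverseʳ _ ⟩
        0#                                ≈⟨ zeroˡ C ⟨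
        0# * C                            ∎

      base₁ : H s * G (k ℤ.+ + 1) + 1# * H (s ℤ.- + 1) * G k ≈ 1# * C
      base₁ = begin
        H s * G (k ℤ.+ + 1) + 1# * H (s ℤ.- + 1) * G k   ≈⟨ +-congˡ (*-congʳ (*-identityˡ _)) ⟩
        H s * G (k ℤ.+ + 1) + H (s ℤ.- + 1) * G k        ≈⟨ cross-sum-by-seeds s k ⟩
        C                                                 ≈⟨ *-identityˡ C ⟨
        1# * C                                            ∎

proposition28 : {c ℓ : Level} (R : CommutativeRing c ℓ) →
    let open CommutativeRing R in
    (G H : ℤ → Carrier) → IsGibonacci R G → IsGibonacci R H →
    (r s k : ℤ) →
      H s * G (k ℤ.+ r) + sign R (r ℤ.- + 1) * H (s ℤ.- r) * G k
        ≈ fib R r * (G (+ 0) * H (k ℤ.+ s ℤ.- + 1) + G (+ 1) * H (k ℤ.+ s))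
proposition28 R G H (recG , _) (recH , _) = recurrent-product-identity R recG recH
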